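{- For integers $r\ge1$ and $n\ge0$ define the Schmidt polynomial $S_n^{(r)}(x)=\sum_{k=0}^{n}\binom{n}{k}^r\binom{n+k}{k}^rx^k$. Let $n$ be a positive integer, $r\ge2$ an integer and $x\in\mathbb{Z}$. Then $$\sum_{k=0}^{n-1}(2k+1)S_k^{(r)}(x)\equiv0\pmod n\qquad\text{and}\qquad\sum_{k=0}^{n-1}(-1)^k(2k+1)S_k^{(r)}(x)\equiv0\pmod n.$$ -}

module Defs where

open import Data.Nat as ℕ using (ℕ; zero; suc)
open import Data.Nat.Combinatorics using (_C_)
open import Data.Integer using (ℤ; +_; _+_; _*_; -_; _^_)

sumTo : ℕ → (ℕ → ℤ) → ℤ
sumTo zero    f = + 0
sumTo (suc n) f = sumTo n f + f n

schmidt : ℕ → ℕ → ℤ → ℤ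
schmidt r n x = sumTo (suc n) (λ k → + ((n C k) ℕ.^ r ℕ.* ((n ℕ.+ k) C k) ℕ.^ r) * x ^ k)

sign : ℕ → ℤ
sign zero    = + 1
sign (suc k) = - sign k

module Submission where

-- Put coeff m k = C(k,m) C(k+m,m), so that S_k^(r)(x) = Σ_m coeff m k ^ r x^m and it suffices that n
-- divides Σ_{k<n} w k · coeff m k ^ r for the two weights w. Both sides of the linearisation
-- coeff i k · coeff j k = Σ_d C(i+j,i) C(j,d) C(i+d,j) coeff (i+d) k satisfy the recurrence in i
-- coming from k(k+1) coeff m k = (m+1)² coeff (m+1) k + m(m+1) coeff m k, so every power of a coeff m
-- is a ℕ-linear combination of the coeff m, and r = 1 is enough. There the sums have closed forms:
-- Σ_{k<n} (2k+1) coeff m k = n C(n,m+1) C(n+m,m) and Σ_{k≤n} (-1)^k (2k+1) coeff m k = (-1)^n (n+1) C(n,m) C(n+m+1,m).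

open import Data.Nat as ℕ using (ℕ; zero; suc; _≤_; s≤s)

module Arithmetic where

  open import Data.Nat using (ℕ; zero; suc; _+_; _*_; _^_; _∸_; _≤_)
  open import Data.Nat.Properties
  open import Data.Nat.Tactic.RingSolver using (solve-∀)
  open import Algebra.Properties.CommutativeSemigroup *-commutativeSemigroup using (interchange)
  open import Data.Product using (_,_)
  open import Data.Sum using (_⊎_; inj₁; inj₂)
  open import Relation.Binary.PropositionalEquality

  *-congʳ-unless-zero : ∀ {a b} x → x ≡ 0 ⊎ a ≡ b → a * x ≡ b * x
  *-congʳ-unless-zero {a} {b} _ (inj₁ refl) = trans (*-zeroʳ a) (sym (*-zeroʳ b))
  *-congʳ-unless-zero         _ (inj₂ refl) = refl

  ^-distribʳ-* : ∀ x y r → (x * y) ^ r ≡ x ^ r * y ^ r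
  ^-distribʳ-* x y zero    = refl
  ^-distribʳ-* x y (suc r) = trans (cong (x * y *_) (^-distribʳ-* x y r)) (interchange x y (x ^ r) (y ^ r))

  pronic-difference : ∀ {m k} → m ≤ k → k * suc k ≡ (k ∸ m) * suc (k + m) + m * suc m
  pronic-difference {m} m≤k with m≤n⇒∃[o]m+o≡n m≤k
  ... | t , refl rewrite m+n∸m≡n m t = expand m t
    where
    expand : ∀ m t → (m + t) * suc (m + t) ≡ t * suc (m + t + m) + m * suc m
    expand = solve-∀


module Binomial where

  open import Data.Nat using (ℕ; zero; suc; _+_; _*_; _∸_; _<_; s≤s)
  open import Data.Nat.Properties
  open import Data.Nat.Combinatorics using (_C_; nCk+nC[k+1]≡[n+1]C[k+1]; nC1≡n)
  open import Data.Nat.Tactic.RingSolver using (solve-∀)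
  open import Algebra.Properties.CommutativeSemigroup *-commutativeSemigroup using (x∙yz≈y∙xz)
  open import Relation.Binary.PropositionalEquality
  open ≡-Reasoning

  -- The library's _C_ is defined by division; Pascal's rule is the definition that suits induction.
  binom : ℕ → ℕ → ℕ
  binom n       zero    = 1
  binom zero    (suc k) = 0
  binom (suc n) (suc k) = binom n k + binom n (suc k)

  binom≡C : ∀ n k → binom n k ≡ n C k
  binom≡C n       zero    = refl
  binom≡C zero    (suc k) = refl
  binom≡C (suc n) (suc k) =
    trans (cong₂ _+_ (binom≡C n k) (binom≡C n (suc k))) (nCk+nC[k+1]≡[n+1]C[k+1] n k)

  n<k⇒binom≡0 : ∀ {n k} → n < k → binom n k ≡ 0
  n<k⇒binom≡0 {zero}  {suc k} _         = refl
  n<k⇒binom≡0 {suc n} {suc k} (s≤s n<k) =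
    cong₂ _+_ (n<k⇒binom≡0 n<k) (n<k⇒binom≡0 (m<n⇒m<1+n n<k))

  binom-diagonal : ∀ n → binom n n ≡ 1
  binom-diagonal zero    = refl
  binom-diagonal (suc n) = cong₂ _+_ (binom-diagonal n) (n<k⇒binom≡0 (n<1+n n))

  binom-absorption : ∀ n k → suc k * binom (suc n) (suc k) ≡ suc n * binom n k
  binom-absorption zero    zero    = refl
  binom-absorption zero    (suc k) = *-zeroʳ (suc (suc k))
  binom-absorption (suc n) zero    = begin
    1 * binom (suc (suc n)) 1 ≡⟨ *-identityˡ _ ⟩
    binom (suc (suc n)) 1     ≡⟨ trans (binom≡C (suc (suc n)) 1) (nC1≡n (suc (suc n))) ⟩
    suc (suc n)               ≡⟨ *-identityʳ _ ⟨
    suc (suc n) * 1           ∎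
  binom-absorption (suc n) (suc k) = begin
    suc (suc k) * (p + q + w)                    ≡⟨ expand k p q w ⟩
    suc k * (p + q) + (p + q) + suc (suc k) * w  ≡⟨ cong₂ (λ u v → u + (p + q) + v)
                                                      (binom-absorption n k) (binom-absorption n (suc k)) ⟩
    suc n * p + (p + q) + suc n * q              ≡⟨ collect n p q ⟩
    suc (suc n) * (p + q)                        ∎
    where
    p = binom n k
    q = binom n (suc k)
    w = binom (suc n) (suc (suc k))
    expand : ∀ k p q w → suc (suc k) * (p + q + w) ≡ suc k * (p + q) + (p + q) + suc (suc k) * w
    expand = solve-∀
    collect : ∀ n p q → suc n * p + (p + q) + suc n * q ≡ suc (suc n) * (p + q)
    collect = solve-∀

  binom-lower : ∀ n k → suc k * binom n (suc k) ≡ (n ∸ k) * binom n k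
  binom-lower n k = begin
    suc k * binom n (suc k)                ≡⟨ m+n∸n≡m (suc k * binom n (suc k)) (suc k * binom n k) ⟨
    suc k * binom n (suc k) + suc k * binom n k ∸ suc k * binom n k
                                           ≡⟨ cong (_∸ suc k * binom n k) pascal ⟩
    suc n * binom n k ∸ suc k * binom n k  ≡⟨ *-distribʳ-∸ (binom n k) (suc n) (suc k) ⟨
    (n ∸ k) * binom n k                    ∎
    where
    pascal : suc k * binom n (suc k) + suc k * binom n k ≡ suc n * binom n k
    pascal = begin
      suc k * binom n (suc k) + suc k * binom n k ≡⟨ +-comm (suc k * binom n (suc k)) _ ⟩
      suc k * binom n k + suc k * binom n (suc k) ≡⟨ *-distribˡ-+ (suc k) (binom n k) (binom n (suc k)) ⟨
      suc k * binom (suc n) (suc k)               ≡⟨ binom-absorption n k ⟩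
      suc n * binom n k                           ∎

  binom-upper : ∀ n k → suc n * binom n k ≡ (suc n ∸ k) * binom (suc n) k
  binom-upper n zero    = refl
  binom-upper n (suc k) = *-cancelˡ-≡ _ _ (suc k) (begin
    suc k * (suc n * binom n (suc k))         ≡⟨ x∙yz≈y∙xz (suc k) (suc n) _ ⟩
    suc n * (suc k * binom n (suc k))         ≡⟨ cong (suc n *_) (binom-lower n k) ⟩
    suc n * ((n ∸ k) * binom n k)             ≡⟨ x∙yz≈y∙xz (suc n) (n ∸ k) _ ⟩
    (n ∸ k) * (suc n * binom n k)             ≡⟨ cong ((n ∸ k) *_) (binom-absorption n k) ⟨
    (n ∸ k) * (suc k * binom (suc n) (suc k)) ≡⟨ x∙yz≈y∙xz (n ∸ k) (suc k) _ ⟩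
    suc k * ((n ∸ k) * binom (suc n) (suc k)) ∎)


module NatSum where

  open import Data.Nat using (ℕ; zero; suc; _+_; _*_; _<_)
  open import Data.Nat.Properties
  open import Algebra.Properties.CommutativeSemigroup +-commutativeSemigroup
    using (interchange; x∙yz≈y∙xz)
  open import Relation.Binary.PropositionalEquality

  sumℕ : ℕ → (ℕ → ℕ) → ℕ
  sumℕ zero    f = 0
  sumℕ (suc n) f = sumℕ n f + f n

  sumℕ-cong : ∀ n {f g} → (∀ d → f d ≡ g d) → sumℕ n f ≡ sumℕ n g
  sumℕ-cong zero    f≗g = refl
  sumℕ-cong (suc n) f≗g = cong₂ _+_ (sumℕ-cong n f≗g) (f≗g n)

  sumℕ-+ : ∀ n f g → sumℕ n (λ d → f d + g d) ≡ sumℕ n f + sumℕ n g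
  sumℕ-+ zero    f g = refl
  sumℕ-+ (suc n) f g =
    trans (cong (_+ (f n + g n)) (sumℕ-+ n f g)) (interchange (sumℕ n f) (sumℕ n g) (f n) (g n))

  sumℕ-*ˡ : ∀ n c f → sumℕ n (λ d → c * f d) ≡ c * sumℕ n f
  sumℕ-*ˡ zero    c f = sym (*-zeroʳ c)
  sumℕ-*ˡ (suc n) c f =
    trans (cong (_+ c * f n) (sumℕ-*ˡ n c f)) (sym (*-distribˡ-+ c (sumℕ n f) (f n)))

  sumℕ-zero : ∀ n f → (∀ d → d < n → f d ≡ 0) → sumℕ n f ≡ 0
  sumℕ-zero zero    f f≡0 = refl
  sumℕ-zero (suc n) f f≡0 =
    cong₂ _+_ (sumℕ-zero n f (λ d d<n → f≡0 d (m<n⇒m<1+n d<n))) (f≡0 n (n<1+n n))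

  sumℕ-suc : ∀ n f → sumℕ (suc n) f ≡ f 0 + sumℕ n (λ d → f (suc d))
  sumℕ-suc zero    f = sym (+-identityʳ (f 0))
  sumℕ-suc (suc n) f = trans (cong (_+ f (suc n)) (sumℕ-suc n f)) (+-assoc (f 0) _ _)

  sumℕ-shift : ∀ n f → f (suc n) ≡ 0 → sumℕ (suc n) f ≡ f 0 + sumℕ (suc n) (λ d → f (suc d))
  sumℕ-shift n f last≡0 = begin
    sumℕ (suc n) f                        ≡⟨ sumℕ-suc n f ⟩
    f 0 + sumℕ n (λ d → f (suc d))        ≡⟨ cong (f 0 +_) (+-identityʳ _) ⟨
    f 0 + (sumℕ n (λ d → f (suc d)) + 0)  ≡⟨ cong (λ z → f 0 + (sumℕ n (λ d → f (suc d)) + z)) last≡0 ⟨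
    f 0 + sumℕ (suc n) (λ d → f (suc d))  ∎
    where open ≡-Reasoning

  sumℕ-+-shift : ∀ n f g → g (suc n) ≡ 0 →
    sumℕ (suc n) (λ d → f d + g d) ≡ g 0 + sumℕ (suc n) (λ d → f d + g (suc d))
  sumℕ-+-shift n f g last≡0 = begin
    sumℕ (suc n) (λ d → f d + g d)
      ≡⟨ sumℕ-+ (suc n) f g ⟩
    sumℕ (suc n) f + sumℕ (suc n) g
      ≡⟨ cong (sumℕ (suc n) f +_) (sumℕ-shift n g last≡0) ⟩
    sumℕ (suc n) f + (g 0 + sumℕ (suc n) (λ d → g (suc d)))
      ≡⟨ x∙yz≈y∙xz (sumℕ (suc n) f) (g 0) _ ⟩
    g 0 + (sumℕ (suc n) f + sumℕ (suc n) (λ d → g (suc d)))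
      ≡⟨ cong (g 0 +_) (sumℕ-+ (suc n) f (λ d → g (suc d))) ⟨
    g 0 + sumℕ (suc n) (λ d → f d + g (suc d)) ∎
    where open ≡-Reasoning


module LinearSpan (b : ℕ → ℕ → ℕ) where

  open import Data.Nat using (ℕ; zero; suc; _+_; _*_; _^_)
  open import Data.Nat.Properties
  open import Algebra.Properties.CommutativeSemigroup *-commutativeSemigroup
    using (x∙yz≈y∙xz)
  open import Relation.Binary.PropositionalEquality
  open NatSum

  -- Pointwise equality is a constructor because there is no function extensionality.
  data Span : (ℕ → ℕ) → Set where
    basis     : ∀ m → Span (b m)
    add       : ∀ {f g} → Span f → Span g → Span (λ k → f k + g k)
    scale     : ∀ c {f} → Span f → Span (λ k → c * f k)
    pointwise : ∀ {f g} → (∀ k → f k ≡ g k) → Span f → Span g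

  Span-sum : ∀ N (F : ℕ → ℕ → ℕ) → (∀ d → Span (F d)) → Span (λ k → sumℕ N (λ d → F d k))
  Span-sum zero    F F∈ = scale 0 (basis 0)
  Span-sum (suc N) F F∈ = add (Span-sum N F F∈) (F∈ N)

  module _ (basis-products : ∀ i j → Span (λ k → b i k * b j k)) where

    Span-*ˡ-basis : ∀ m {g} → Span g → Span (λ k → b m k * g k)
    Span-*ˡ-basis m (basis j)          = basis-products m j
    Span-*ˡ-basis m (add g₁∈ g₂∈)      =
      pointwise (λ k → sym (*-distribˡ-+ (b m k) _ _)) (add (Span-*ˡ-basis m g₁∈) (Span-*ˡ-basis m g₂∈))
    Span-*ˡ-basis m (scale c g∈)       =
      pointwise (λ k → x∙yz≈y∙xz c (b m k) _) (scale c (Span-*ˡ-basis m g∈))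
    Span-*ˡ-basis m (pointwise g≗h g∈) =
      pointwise (λ k → cong (b m k *_) (g≗h k)) (Span-*ˡ-basis m g∈)

    Span-* : ∀ {f g} → Span f → Span g → Span (λ k → f k * g k)
    Span-* (basis m)          g∈ = Span-*ˡ-basis m g∈
    Span-* {g = g} (add {f₁} {f₂} f₁∈ f₂∈) g∈ =
      pointwise (λ k → sym (*-distribʳ-+ (g k) (f₁ k) (f₂ k))) (add (Span-* f₁∈ g∈) (Span-* f₂∈ g∈))
    Span-* (scale c f∈)       g∈ = pointwise (λ k → sym (*-assoc c _ _)) (scale c (Span-* f∈ g∈))
    Span-* (pointwise f≗h f∈) g∈ = pointwise (λ k → cong (_* _) (f≗h k)) (Span-* f∈ g∈)

    Span-^ : Span (λ _ → 1) → ∀ {f} → Span f → ∀ r → Span (λ k → f k ^ r)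
    Span-^ 1∈ f∈ zero    = 1∈
    Span-^ 1∈ f∈ (suc r) = Span-* f∈ (Span-^ 1∈ f∈ r)


module SchmidtCoefficient where

  open import Data.Nat using (ℕ; zero; suc; _+_; _*_; _^_; _∸_; _≤_; _<_; _≤?_)
  open import Data.Nat.Properties
  open import Data.Nat.Tactic.RingSolver using (solve-∀)
  open import Data.Nat.Combinatorics using (_C_)
  open import Algebra.Properties.CommutativeSemigroup *-commutativeSemigroup using (x∙yz≈y∙xz)
  open import Data.Product using (_,_)
  open import Data.Sum using (_⊎_; inj₁; inj₂; map₁; map₂)
  open import Relation.Nullary using (yes; no)
  open import Relation.Binary.PropositionalEquality
  open ≡-Reasoning
  open Arithmetic
  open Binomial
  open NatSum

  coeff : ℕ → ℕ → ℕ
  coeff m k = binom k m * binom (k + m) m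

  coeff^≡C^ : ∀ r m k → coeff m k ^ r ≡ (k C m) ^ r * ((k + m) C m) ^ r
  coeff^≡C^ r m k = trans (^-distribʳ-* (binom k m) (binom (k + m) m) r)
                          (cong₂ (λ u v → u ^ r * v ^ r) (binom≡C k m) (binom≡C (k + m) m))

  coeff-vanish : ∀ {m k} → k < m → coeff m k ≡ 0
  coeff-vanish {m} {k} k<m = cong (_* binom (k + m) m) (n<k⇒binom≡0 k<m)

  coeff≡0⊎≤ : ∀ m k → coeff m k ≡ 0 ⊎ m ≤ k
  coeff≡0⊎≤ m k with m ≤? k
  ... | yes m≤k = inj₂ m≤k
  ... | no  m≰k = inj₁ (coeff-vanish (≰⇒> m≰k))

  coeff-raise : ∀ m k → suc m * suc m * coeff (suc m) k ≡ (k ∸ m) * suc (k + m) * coeff m k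
  coeff-raise m k = begin
    suc m * suc m * (binom k (suc m) * binom (k + suc m) (suc m))
      ≡⟨ pair (suc m) (binom k (suc m)) (binom (k + suc m) (suc m)) ⟩
    (suc m * binom k (suc m)) * (suc m * binom (k + suc m) (suc m))
      ≡⟨ cong₂ _*_ (binom-lower k m) (trans (cong (λ n → suc m * binom n (suc m)) (+-suc k m))
                                            (binom-absorption (k + m) m)) ⟩
    ((k ∸ m) * binom k m) * (suc (k + m) * binom (k + m) m)
      ≡⟨ unpair (k ∸ m) (suc (k + m)) (binom k m) (binom (k + m) m) ⟩
    (k ∸ m) * suc (k + m) * coeff m k ∎
    where
    pair : ∀ c x y → c * c * (x * y) ≡ (c * x) * (c * y)
    pair = solve-∀
    unpair : ∀ c d x y → (c * x) * (d * y) ≡ c * d * (x * y)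
    unpair = solve-∀

  coeff-recurrence : ∀ m k →
    k * suc k * coeff m k ≡ suc m * suc m * coeff (suc m) k + m * suc m * coeff m k
  coeff-recurrence m k = begin
    k * suc k * coeff m k
      ≡⟨ *-congʳ-unless-zero (coeff m k) (map₂ pronic-difference (coeff≡0⊎≤ m k)) ⟩
    ((k ∸ m) * suc (k + m) + m * suc m) * coeff m k
      ≡⟨ *-distribʳ-+ (coeff m k) ((k ∸ m) * suc (k + m)) (m * suc m) ⟩
    (k ∸ m) * suc (k + m) * coeff m k + m * suc m * coeff m k
      ≡⟨ cong (_+ m * suc m * coeff m k) (coeff-raise m k) ⟨
    suc m * suc m * coeff (suc m) k + m * suc m * coeff m k ∎

  linCoeff : ℕ → ℕ → ℕ → ℕ
  linCoeff i j d = binom (i + j) i * binom j d * binom (i + d) j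

  linCoeff-beyond : ∀ i j → linCoeff i j (suc j) ≡ 0
  linCoeff-beyond i j = trans (cong (λ b → binom (i + j) i * b * binom (i + suc j) j) (n<k⇒binom≡0 (n<1+n j)))
                              (cong (_* binom (i + suc j) j) (*-zeroʳ (binom (i + j) i)))

  linCoeff-weights : ∀ i d s t → suc i ≡ s + t →
    suc d * suc i * suc (i + (d + s)) + i * suc i * s
    ≡ suc d * suc (i + d) * t + suc (i + d) * suc (suc (i + d)) * s
  linCoeff-weights i d s t i+1≡s+t = +-cancelʳ-≡ (suc d * suc (i + d) * s) _ _ (begin
    suc d * suc i * suc (i + (d + s)) + i * suc i * s + suc d * suc (i + d) * s
      ≡⟨ expand i d s ⟩
    suc d * suc (i + d) * suc i + suc (i + d) * suc (suc (i + d)) * s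
      ≡⟨ cong (λ u → suc d * suc (i + d) * u + suc (i + d) * suc (suc (i + d)) * s) i+1≡s+t ⟩
    suc d * suc (i + d) * (s + t) + suc (i + d) * suc (suc (i + d)) * s
      ≡⟨ collect i d s t ⟩
    suc d * suc (i + d) * t + suc (i + d) * suc (suc (i + d)) * s + suc d * suc (i + d) * s ∎)
    where
    expand : ∀ i d s → suc d * suc i * suc (i + (d + s)) + i * suc i * s + suc d * suc (i + d) * s
                       ≡ suc d * suc (i + d) * suc i + suc (i + d) * suc (suc (i + d)) * s
    expand = solve-∀
    collect : ∀ i d s t → suc d * suc (i + d) * (s + t) + suc (i + d) * suc (suc (i + d)) * s
                          ≡ suc d * suc (i + d) * t + suc (i + d) * suc (suc (i + d)) * s + suc d * suc (i + d) * s
    collect = solve-∀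

  linCoeff-weights-agree : ∀ i j d → let n = suc (i + d) in
    binom j d * binom n j ≡ 0
    ⊎ suc d * suc i * suc (i + j) + i * suc i * (j ∸ d) ≡ suc d * n * (n ∸ j) + n * suc n * (j ∸ d)
  linCoeff-weights-agree i j d with d ≤? j
  ... | no d≰j = inj₁ (cong (_* binom (suc (i + d)) j) (n<k⇒binom≡0 (≰⇒> d≰j)))
  ... | yes d≤j with j ≤? suc (i + d)
  ...   | no j≰n  = inj₁ (trans (cong (binom j d *_) (n<k⇒binom≡0 (≰⇒> j≰n))) (*-zeroʳ (binom j d)))
  ...   | yes j≤n = inj₂ (trans (cong (λ m → suc d * suc i * suc (i + m) + i * suc i * s) (sym (m+[n∸m]≡n d≤j)))
                                (linCoeff-weights i d s t i+1≡s+t))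
    where
    s = j ∸ d
    t = suc (i + d) ∸ j
    i+1≡s+t : suc i ≡ s + t
    i+1≡s+t = +-cancelʳ-≡ d _ _ (begin
      suc (i + d)   ≡⟨ m+[n∸m]≡n j≤n ⟨
      j + t         ≡⟨ cong (_+ t) (m+[n∸m]≡n d≤j) ⟨
      d + s + t     ≡⟨ trans (+-assoc d s t) (+-comm d (s + t)) ⟩
      s + t + d     ∎)

  -- Multiplied by d + 1, both sides become multiples of C(i+j,i) C(j,d) C(i+d+1,j) by absorption
  -- and the ratio identities, with weights that agree whenever that product is nonzero.
  linCoeff-recurrence : ∀ i j d →
    suc i * suc i * linCoeff (suc i) j d + i * suc i * linCoeff i j (suc d)
    ≡ suc (i + d) * suc (i + d) * linCoeff i j d
      + suc (i + d) * suc (suc (i + d)) * linCoeff i j (suc d)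
  linCoeff-recurrence i j d = *-cancelˡ-≡ _ _ (suc d) (begin
    suc d * (suc i * suc i * (P′ * Q * R′) + i * suc i * linCoeff i j (suc d))
      ≡⟨ cong (λ e → suc d * (suc i * suc i * (P′ * Q * R′) + i * suc i * e)) shifted ⟩
    suc d * (suc i * suc i * (P′ * Q * R′) + i * suc i * (P * Q′ * R′))
      ≡⟨ regroupˡ (suc d) (suc i) i P′ P Q Q′ R′ ⟩
    suc d * suc i * (suc i * P′) * Q * R′ + i * suc i * P * (suc d * Q′) * R′
      ≡⟨ cong₂ (λ u v → suc d * suc i * u * Q * R′ + i * suc i * P * v * R′)
               (binom-absorption (i + j) i) (binom-lower j d) ⟩
    suc d * suc i * (suc (i + j) * P) * Q * R′ + i * suc i * P * ((j ∸ d) * Q) * R′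
      ≡⟨ collectˡ (suc d) (suc i) i (suc (i + j)) (j ∸ d) P Q R′ ⟩
    (suc d * suc i * suc (i + j) + i * suc i * (j ∸ d)) * (P * Q * R′)
      ≡⟨ *-congʳ-unless-zero (P * Q * R′) (map₁ vanish (linCoeff-weights-agree i j d)) ⟩
    (suc d * n * (n ∸ j) + n * suc n * (j ∸ d)) * (P * Q * R′)
      ≡⟨ collectʳ (suc d) n (n ∸ j) (j ∸ d) P Q R′ ⟨
    suc d * n * P * Q * ((n ∸ j) * R′) + n * suc n * P * ((j ∸ d) * Q) * R′
      ≡⟨ cong₂ (λ u v → suc d * n * P * Q * u + n * suc n * P * v * R′)
               (binom-upper (i + d) j) (binom-lower j d) ⟨
    suc d * n * P * Q * (n * R) + n * suc n * P * (suc d * Q′) * R′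
      ≡⟨ regroupʳ (suc d) n P Q Q′ R R′ ⟩
    suc d * (n * n * (P * Q * R) + n * suc n * (P * Q′ * R′))
      ≡⟨ cong (λ e → suc d * (n * n * (P * Q * R) + n * suc n * e)) shifted ⟨
    suc d * (n * n * linCoeff i j d + n * suc n * linCoeff i j (suc d)) ∎)
    where
    n = suc (i + d)
    P = binom (i + j) i
    P′ = binom (suc (i + j)) (suc i)
    Q = binom j d
    Q′ = binom j (suc d)
    R = binom (i + d) j
    R′ = binom n j

    shifted : linCoeff i j (suc d) ≡ P * Q′ * R′
    shifted = cong (λ m → P * Q′ * binom m j) (+-suc i d)

    vanish : Q * R′ ≡ 0 → P * Q * R′ ≡ 0
    vanish QR′≡0 = trans (*-assoc P Q R′) (trans (cong (P *_) QR′≡0) (*-zeroʳ P))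

    regroupˡ : ∀ e a b P′ P Q Q′ R′ → e * (a * a * (P′ * Q * R′) + b * a * (P * Q′ * R′))
                                      ≡ e * a * (a * P′) * Q * R′ + b * a * P * (e * Q′) * R′
    regroupˡ = solve-∀
    collectˡ : ∀ e a b c w P Q R′ → e * a * (c * P) * Q * R′ + b * a * P * (w * Q) * R′
                                   ≡ (e * a * c + b * a * w) * (P * Q * R′)
    collectˡ = solve-∀
    collectʳ : ∀ e n t s P Q R′ → e * n * P * Q * (t * R′) + n * suc n * P * (s * Q) * R′
                                 ≡ (e * n * t + n * suc n * s) * (P * Q * R′)
    collectʳ = solve-∀
    regroupʳ : ∀ e n P Q Q′ R R′ → e * n * P * Q * (n * R) + n * suc n * P * (e * Q′) * R′
                                   ≡ e * (n * n * (P * Q * R) + n * suc n * (P * Q′ * R′))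
    regroupʳ = solve-∀

  expansion : ℕ → ℕ → ℕ → ℕ
  expansion i j k = sumℕ (suc j) (λ d → linCoeff i j d * coeff (i + d) k)

  expansion-recurrence : ∀ i j k →
    k * suc k * expansion i j k ≡ suc i * suc i * expansion (suc i) j k + i * suc i * expansion i j k
  expansion-recurrence i j k = begin
    k * suc k * sumℕ (suc j) (term i)
      ≡⟨ sumℕ-*ˡ (suc j) (k * suc k) (term i) ⟨
    sumℕ (suc j) (λ d → k * suc k * term i d)
      ≡⟨ sumℕ-cong (suc j) raise ⟩
    sumℕ (suc j) (λ d → F d + G d)
      ≡⟨ sumℕ-+-shift j F G (scaled-beyond ((i + suc j) * suc (i + suc j))) ⟩
    G 0 + sumℕ (suc j) (λ d → F d + G (suc d))
      ≡⟨ cong₂ _+_ (cong (λ m → m * suc m * term i 0) (+-identityʳ i)) (sumℕ-cong (suc j) termwise) ⟩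
    i * suc i * term i 0 + sumℕ (suc j) (λ d → suc i * suc i * term (suc i) d + i * suc i * term i (suc d))
      ≡⟨ sumℕ-+-shift j (λ d → suc i * suc i * term (suc i) d) (λ d → i * suc i * term i d)
                      (scaled-beyond (i * suc i)) ⟨
    sumℕ (suc j) (λ d → suc i * suc i * term (suc i) d + i * suc i * term i d)
      ≡⟨ sumℕ-+ (suc j) (λ d → suc i * suc i * term (suc i) d) (λ d → i * suc i * term i d) ⟩
    sumℕ (suc j) (λ d → suc i * suc i * term (suc i) d) + sumℕ (suc j) (λ d → i * suc i * term i d)
      ≡⟨ cong₂ _+_ (sumℕ-*ˡ (suc j) (suc i * suc i) (term (suc i))) (sumℕ-*ˡ (suc j) (i * suc i) (term i)) ⟩
    suc i * suc i * expansion (suc i) j k + i * suc i * expansion i j k ∎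
    where
    term : ℕ → ℕ → ℕ
    term m d = linCoeff m j d * coeff (m + d) k

    F G : ℕ → ℕ
    F d = suc (i + d) * suc (i + d) * (linCoeff i j d * coeff (suc (i + d)) k)
    G d = (i + d) * suc (i + d) * term i d

    scaled-beyond : ∀ c → c * term i (suc j) ≡ 0
    scaled-beyond c = trans (cong (λ e → c * (e * coeff (i + suc j) k)) (linCoeff-beyond i j)) (*-zeroʳ c)

    raise : ∀ d → k * suc k * term i d ≡ F d + G d
    raise d = begin
      k * suc k * (linCoeff i j d * coeff (i + d) k)  ≡⟨ x∙yz≈y∙xz (k * suc k) (linCoeff i j d) _ ⟩
      linCoeff i j d * (k * suc k * coeff (i + d) k)  ≡⟨ cong (linCoeff i j d *_) (coeff-recurrence (i + d) k) ⟩
      linCoeff i j d * (suc (i + d) * suc (i + d) * coeff (suc (i + d)) k + (i + d) * suc (i + d) * coeff (i + d) k)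
        ≡⟨ distribute (suc (i + d) * suc (i + d)) ((i + d) * suc (i + d)) (linCoeff i j d) _ _ ⟩
      F d + G d ∎
      where
      distribute : ∀ u v e x y → e * (u * x + v * y) ≡ u * (e * x) + v * (e * y)
      distribute = solve-∀

    termwise : ∀ d → F d + G (suc d) ≡ suc i * suc i * term (suc i) d + i * suc i * term i (suc d)
    termwise d = begin
      F d + (i + suc d) * suc (i + suc d) * (E₁ * coeff (i + suc d) k)
        ≡⟨ cong (λ m → F d + m * suc m * (E₁ * coeff m k)) (+-suc i d) ⟩
      n * n * (E₀ * A) + n * suc n * (E₁ * A)            ≡⟨ factor (n * n) (n * suc n) E₀ E₁ A ⟩
      (n * n * E₀ + n * suc n * E₁) * A                  ≡⟨ cong (_* A) (linCoeff-recurrence i j d) ⟨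
      (suc i * suc i * E′ + i * suc i * E₁) * A          ≡⟨ factor (suc i * suc i) (i * suc i) E′ E₁ A ⟨
      suc i * suc i * (E′ * A) + i * suc i * (E₁ * A)
        ≡⟨ cong (λ m → suc i * suc i * (E′ * A) + i * suc i * (E₁ * coeff m k)) (+-suc i d) ⟨
      suc i * suc i * term (suc i) d + i * suc i * term i (suc d) ∎
      where
      n = suc (i + d)
      A = coeff n k
      E₀ = linCoeff i j d
      E₁ = linCoeff i j (suc d)
      E′ = linCoeff (suc i) j d
      factor : ∀ u v x y a → u * (x * a) + v * (y * a) ≡ (u * x + v * y) * a
      factor = solve-∀

  coeff-product : ∀ i j k → coeff i k * coeff j k ≡ expansion i j k
  coeff-product zero    j k = sym (cong₂ _+_ (sumℕ-zero j _ below) (cong (_* coeff j k) diagonal))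
    where
    below : ∀ d → d < j → linCoeff 0 j d * coeff d k ≡ 0
    below d d<j = cong (_* coeff d k) (trans (cong (1 * binom j d *_) (n<k⇒binom≡0 d<j)) (*-zeroʳ (1 * binom j d)))
    diagonal : linCoeff 0 j j ≡ 1
    diagonal = cong₂ (λ x y → 1 * x * y) (binom-diagonal j) (binom-diagonal j)
  coeff-product (suc i) j k =
    *-cancelˡ-≡ _ _ (suc i * suc i) (+-cancelʳ-≡ (i * suc i * (coeff i k * coeff j k)) _ _ (begin
      suc i * suc i * (coeff (suc i) k * coeff j k) + i * suc i * (coeff i k * coeff j k)
        ≡⟨ factor (suc i * suc i) (i * suc i) (coeff (suc i) k) (coeff i k) (coeff j k) ⟩
      (suc i * suc i * coeff (suc i) k + i * suc i * coeff i k) * coeff j k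
        ≡⟨ cong (_* coeff j k) (coeff-recurrence i k) ⟨
      k * suc k * coeff i k * coeff j k
        ≡⟨ *-assoc (k * suc k) (coeff i k) (coeff j k) ⟩
      k * suc k * (coeff i k * coeff j k)
        ≡⟨ cong (k * suc k *_) (coeff-product i j k) ⟩
      k * suc k * expansion i j k
        ≡⟨ expansion-recurrence i j k ⟩
      suc i * suc i * expansion (suc i) j k + i * suc i * expansion i j k
        ≡⟨ cong (λ e → suc i * suc i * expansion (suc i) j k + i * suc i * e) (coeff-product i j k) ⟨
      suc i * suc i * expansion (suc i) j k + i * suc i * (coeff i k * coeff j k) ∎))
    where
    factor : ∀ u v x y z → u * (x * z) + v * (y * z) ≡ (u * x + v * y) * z
    factor = solve-∀

  open LinearSpan coeff

  coeff-products-Span : ∀ i j → Span (λ k → coeff i k * coeff j k)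
  coeff-products-Span i j =
    pointwise (λ k → sym (coeff-product i j k))
              (Span-sum (suc j) (λ d k → linCoeff i j d * coeff (i + d) k)
                        (λ d → scale (linCoeff i j d) (basis (i + d))))

  coeff-powers-Span : ∀ j r → Span (λ k → coeff j k ^ r)
  coeff-powers-Span j = Span-^ coeff-products-Span (basis 0) (basis j)

  odd-weighted-coeff-sum-scaled : ∀ n m →
    suc m * sumℕ n (λ k → suc (2 * k) * coeff m k) ≡ n * (n ∸ m) * coeff m n
  odd-weighted-coeff-sum-scaled zero    m = *-zeroʳ (suc m)
  odd-weighted-coeff-sum-scaled (suc n) m = begin
    suc m * (sumℕ n (λ k → suc (2 * k) * coeff m k) + suc (2 * n) * coeff m n)
      ≡⟨ *-distribˡ-+ (suc m) (sumℕ n (λ k → suc (2 * k) * coeff m k)) (suc (2 * n) * coeff m n) ⟩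
    suc m * sumℕ n (λ k → suc (2 * k) * coeff m k) + suc m * (suc (2 * n) * coeff m n)
      ≡⟨ cong (_+ suc m * (suc (2 * n) * coeff m n)) (odd-weighted-coeff-sum-scaled n m) ⟩
    n * (n ∸ m) * coeff m n + suc m * (suc (2 * n) * coeff m n)
      ≡⟨ factor (n * (n ∸ m)) (suc m) (suc (2 * n)) (coeff m n) ⟩
    (n * (n ∸ m) + suc m * suc (2 * n)) * coeff m n
      ≡⟨ *-congʳ-unless-zero (coeff m n) (map₂ weights (coeff≡0⊎≤ m n)) ⟩
    suc n * suc (n + m) * (binom n m * binom (n + m) m)
      ≡⟨ pair (suc n) (suc (n + m)) (binom n m) (binom (n + m) m) ⟩
    (suc n * binom n m) * (suc (n + m) * binom (n + m) m)
      ≡⟨ cong₂ _*_ (binom-upper n m) (trans (binom-upper (n + m) m)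
                                            (cong (_* binom (suc n + m) m) (m+n∸n≡m (suc n) m))) ⟩
    ((suc n ∸ m) * binom (suc n) m) * (suc n * binom (suc n + m) m)
      ≡⟨ unpair (suc n ∸ m) (suc n) (binom (suc n) m) (binom (suc n + m) m) ⟩
    suc n * (suc n ∸ m) * coeff m (suc n) ∎
    where
    weights : ∀ {m n} → m ≤ n → n * (n ∸ m) + suc m * suc (2 * n) ≡ suc n * suc (n + m)
    weights {m} m≤n with m≤n⇒∃[o]m+o≡n m≤n
    ... | t , refl rewrite m+n∸m≡n m t = expand m t
      where
      expand : ∀ m t → (m + t) * t + suc m * suc (2 * (m + t)) ≡ suc (m + t) * suc (m + t + m)
      expand = solve-∀
    factor : ∀ x c w a → x * a + c * (w * a) ≡ (x + c * w) * a
    factor = solve-∀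
    pair : ∀ u v x y → u * v * (x * y) ≡ (u * x) * (v * y)
    pair = solve-∀
    unpair : ∀ u v x y → (u * x) * (v * y) ≡ v * u * (x * y)
    unpair = solve-∀

  odd-weighted-coeff-sum : ∀ n m →
    sumℕ n (λ k → suc (2 * k) * coeff m k) ≡ n * (binom n (suc m) * binom (n + m) m)
  odd-weighted-coeff-sum n m = *-cancelˡ-≡ _ _ (suc m) (begin
    suc m * sumℕ n (λ k → suc (2 * k) * coeff m k) ≡⟨ odd-weighted-coeff-sum-scaled n m ⟩
    n * (n ∸ m) * (binom n m * binom (n + m) m)   ≡⟨ regroup n (n ∸ m) (binom n m) (binom (n + m) m) ⟩
    n * ((n ∸ m) * binom n m) * binom (n + m) m   ≡⟨ cong (λ x → n * x * binom (n + m) m) (binom-lower n m) ⟨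
    n * (suc m * binom n (suc m)) * binom (n + m) m ≡⟨ extract n (suc m) (binom n (suc m)) (binom (n + m) m) ⟩
    suc m * (n * (binom n (suc m) * binom (n + m) m)) ∎)
    where
    regroup : ∀ n d x y → n * d * (x * y) ≡ n * (d * x) * y
    regroup = solve-∀
    extract : ∀ n s x y → n * (s * x) * y ≡ s * (n * (x * y))
    extract = solve-∀

  alternatingClosedForm : ℕ → ℕ → ℕ
  alternatingClosedForm n m = suc n * (binom n m * binom (suc n + m) m)

  alternatingClosedForm-step : ∀ n m →
    alternatingClosedForm n m + alternatingClosedForm (suc n) m ≡ suc (2 * suc n) * coeff m (suc n)
  alternatingClosedForm-step n m = begin
    suc n * (binom n m * B₁) + suc (suc n) * (A₁ * B₂)
      ≡⟨ regroup (suc n) (suc (suc n)) (binom n m) B₁ A₁ B₂ ⟩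
    (suc n * binom n m) * B₁ + A₁ * (suc (suc n) * B₂)
      ≡⟨ cong₂ (λ x y → x * B₁ + A₁ * y) (binom-upper n m) upper₂ ⟩
    ((suc n ∸ m) * A₁) * B₁ + A₁ * (suc (suc n + m) * B₁)
      ≡⟨ factor (suc n ∸ m) (suc (suc n + m)) A₁ B₁ ⟩
    ((suc n ∸ m) + suc (suc n + m)) * (A₁ * B₁)
      ≡⟨ *-congʳ-unless-zero (coeff m (suc n)) (map₂ weights (coeff≡0⊎≤ m (suc n))) ⟩
    suc (2 * suc n) * (A₁ * B₁) ∎
    where
    A₁ = binom (suc n) m
    B₁ = binom (suc n + m) m
    B₂ = binom (suc (suc n) + m) m
    upper₂ : suc (suc n) * B₂ ≡ suc (suc n + m) * B₁
    upper₂ = sym (trans (binom-upper (suc n + m) m) (cong (_* B₂) (m+n∸n≡m (suc (suc n)) m)))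
    weights : ∀ {m l} → m ≤ l → (l ∸ m) + suc (l + m) ≡ suc (2 * l)
    weights {m} m≤l with m≤n⇒∃[o]m+o≡n m≤l
    ... | t , refl rewrite m+n∸m≡n m t = expand m t
      where
      expand : ∀ m t → t + suc (m + t + m) ≡ suc (2 * (m + t))
      expand = solve-∀
    regroup : ∀ u v x y z w → u * (x * y) + v * (z * w) ≡ (u * x) * y + z * (v * w)
    regroup = solve-∀
    factor : ∀ c d x y → (c * x) * y + x * (d * y) ≡ (c + d) * (x * y)
    factor = solve-∀


open import Defs
import Data.Nat.Properties as ℕ
open import Data.Integer using (ℤ; +_; -_; _+_; _*_; _^_)
open import Data.Integer.Properties
open import Data.Integer.Tactic.RingSolver using (solve-∀)
open import Data.Integer.Divisibility using (_∣_)
open import Data.Integer.Divisibility.Signed as Signed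
  using (divides; ∣m∣n⇒∣m+n; ∣n⇒∣m*n; ∣m⇒∣m*n; ∣⇒∣ᵤ)
open import Algebra.Properties.CommutativeSemigroup +-commutativeSemigroup using (interchange)
open import Algebra.Properties.CommutativeSemigroup *-commutativeSemigroup using (x∙yz≈y∙xz)
open import Data.Product using (_×_; _,_)
open import Relation.Binary.PropositionalEquality
open ≡-Reasoning
open Binomial using (binom)
open NatSum using (sumℕ)
open SchmidtCoefficient
open LinearSpan using (Span; basis; add; scale; pointwise)

sumTo-cong< : ∀ n {f g : ℕ → ℤ} → (∀ k → k ℕ.< n → f k ≡ g k) → sumTo n f ≡ sumTo n g
sumTo-cong< zero    f≗g = refl
sumTo-cong< (suc n) f≗g = cong₂ _+_ (sumTo-cong< n (λ k k<n → f≗g k (ℕ.m<n⇒m<1+n k<n))) (f≗g n (ℕ.n<1+n n))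

sumTo-cong : ∀ n {f g : ℕ → ℤ} → (∀ k → f k ≡ g k) → sumTo n f ≡ sumTo n g
sumTo-cong n f≗g = sumTo-cong< n (λ k _ → f≗g k)

sumTo-+ : ∀ n (f g : ℕ → ℤ) → sumTo n (λ k → f k + g k) ≡ sumTo n f + sumTo n g
sumTo-+ zero    f g = refl
sumTo-+ (suc n) f g = trans (cong (_+ (f n + g n)) (sumTo-+ n f g)) (interchange (sumTo n f) (sumTo n g) (f n) (g n))

sumTo-*ˡ : ∀ n c (f : ℕ → ℤ) → sumTo n (λ k → c * f k) ≡ c * sumTo n f
sumTo-*ˡ zero    c f = sym (*-zeroʳ c)
sumTo-*ˡ (suc n) c f = trans (cong (_+ c * f n) (sumTo-*ˡ n c f)) (sym (*-distribˡ-+ c (sumTo n f) (f n)))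

sumTo-*ʳ : ∀ n c (f : ℕ → ℤ) → sumTo n (λ k → f k * c) ≡ sumTo n f * c
sumTo-*ʳ n c f = trans (sumTo-cong n (λ k → *-comm (f k) c)) (trans (sumTo-*ˡ n c f) (*-comm c _))

sumTo-zero : ∀ n → sumTo n (λ _ → + 0) ≡ + 0
sumTo-zero zero    = refl
sumTo-zero (suc n) = cong (_+ + 0) (sumTo-zero n)

sumTo-sumℕ : ∀ n (f : ℕ → ℕ) → sumTo n (λ k → + f k) ≡ + sumℕ n f
sumTo-sumℕ zero    f = refl
sumTo-sumℕ (suc n) f = trans (cong (_+ + f n) (sumTo-sumℕ n f)) (sym (pos-+ (sumℕ n f) (f n)))

sumTo-comm : ∀ n m (F : ℕ → ℕ → ℤ) →
  sumTo n (λ k → sumTo m (λ j → F k j)) ≡ sumTo m (λ j → sumTo n (λ k → F k j))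
sumTo-comm zero    m F = sym (sumTo-zero m)
sumTo-comm (suc n) m F =
  trans (cong (_+ sumTo m (F n)) (sumTo-comm n m F)) (sym (sumTo-+ m (λ j → sumTo n (λ k → F k j)) (F n)))

sumTo-extend : ∀ m p (f : ℕ → ℤ) → (∀ j → m ℕ.≤ j → f j ≡ + 0) → sumTo (m ℕ.+ p) f ≡ sumTo m f
sumTo-extend m zero    f tail≡0 = cong (λ l → sumTo l f) (ℕ.+-identityʳ m)
sumTo-extend m (suc p) f tail≡0 = begin
  sumTo (m ℕ.+ suc p) f             ≡⟨ cong (λ l → sumTo l f) (ℕ.+-suc m p) ⟩
  sumTo (m ℕ.+ p) f + f (m ℕ.+ p)   ≡⟨ cong₂ _+_ (sumTo-extend m p f tail≡0) (tail≡0 (m ℕ.+ p) (ℕ.m≤m+n m p)) ⟩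
  sumTo m f + + 0                   ≡⟨ +-identityʳ _ ⟩
  sumTo m f                         ∎

∣-sumTo : ∀ {d} n (f : ℕ → ℤ) → (∀ k → d Signed.∣ f k) → d Signed.∣ sumTo n f
∣-sumTo zero    f d∣f = divides (+ 0) refl
∣-sumTo (suc n) f d∣f = ∣m∣n⇒∣m+n (∣-sumTo n f d∣f) (d∣f n)

∣-weightedSum-Span : ∀ {b d} n (w : ℕ → ℤ) → (∀ m → d Signed.∣ sumTo n (λ k → w k * + b m k)) →
  ∀ {f} → Span b f → d Signed.∣ sumTo n (λ k → w k * + f k)
∣-weightedSum-Span n w d∣basis (basis m) = d∣basis m
∣-weightedSum-Span {d = d} n w d∣basis (add {f} {g} f∈ g∈) =
  subst (d Signed.∣_) (sym split)
        (∣m∣n⇒∣m+n (∣-weightedSum-Span n w d∣basis f∈) (∣-weightedSum-Span n w d∣basis g∈))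
  where
  split : sumTo n (λ k → w k * + (f k ℕ.+ g k)) ≡ sumTo n (λ k → w k * + f k) + sumTo n (λ k → w k * + g k)
  split = trans (sumTo-cong n (λ k → trans (cong (w k *_) (pos-+ (f k) (g k))) (*-distribˡ-+ (w k) _ _)))
                (sumTo-+ n _ _)
∣-weightedSum-Span {d = d} n w d∣basis (scale c {f} f∈) =
  subst (d Signed.∣_) (sym pull) (∣n⇒∣m*n (+ c) (∣-weightedSum-Span n w d∣basis f∈))
  where
  pull : sumTo n (λ k → w k * + (c ℕ.* f k)) ≡ + c * sumTo n (λ k → w k * + f k)
  pull = trans (sumTo-cong n (λ k → trans (cong (w k *_) (pos-* c (f k))) (x∙yz≈y∙xz (w k) (+ c) (+ f k))))
               (sumTo-*ˡ n (+ c) _)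
∣-weightedSum-Span {d = d} n w d∣basis (pointwise f≗g f∈) =
  subst (d Signed.∣_) (sumTo-cong n (λ k → cong (λ v → w k * + v) (f≗g k)))
        (∣-weightedSum-Span n w d∣basis f∈)

weightedSum-schmidt : ∀ n r (w : ℕ → ℤ) x →
  sumTo n (λ k → w k * schmidt (suc r) k x)
  ≡ sumTo n (λ j → sumTo n (λ k → w k * + (coeff j k ℕ.^ suc r)) * x ^ j)
weightedSum-schmidt n r w x = begin
  sumTo n (λ k → w k * schmidt (suc r) k x)
    ≡⟨ sumTo-cong n (λ k → cong (w k *_) (sumTo-cong (suc k) (λ j →
         cong (λ c → + c * x ^ j) (sym (coeff^≡C^ (suc r) j k))))) ⟩
  sumTo n (λ k → w k * sumTo (suc k) (λ j → + (coeff j k ℕ.^ suc r) * x ^ j))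
    ≡⟨ sumTo-cong n (λ k → sym (sumTo-*ˡ (suc k) (w k) _)) ⟩
  sumTo n (λ k → sumTo (suc k) (term k))
    ≡⟨ sumTo-cong< n (λ k k<n → sym (extend k k<n)) ⟩
  sumTo n (λ k → sumTo n (term k))
    ≡⟨ sumTo-comm n n term ⟩
  sumTo n (λ j → sumTo n (λ k → term k j))
    ≡⟨ sumTo-cong n (λ j → trans (sumTo-cong n (λ k → sym (*-assoc (w k) _ (x ^ j)))) (sumTo-*ʳ n (x ^ j) _)) ⟩
  sumTo n (λ j → sumTo n (λ k → w k * + (coeff j k ℕ.^ suc r)) * x ^ j) ∎
  where
  term : ℕ → ℕ → ℤ
  term k j = w k * (+ (coeff j k ℕ.^ suc r) * x ^ j)

  extend : ∀ k → k ℕ.< n → sumTo n (term k) ≡ sumTo (suc k) (term k)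
  extend k k<n with ℕ.m≤n⇒∃[o]m+o≡n k<n
  ... | p , refl = sumTo-extend (suc k) p (term k) (λ j k<j →
    trans (cong (λ c → w k * (+ (c ℕ.^ suc r) * x ^ j)) (coeff-vanish k<j))
          (trans (cong (w k *_) (*-zeroˡ (x ^ j))) (*-zeroʳ (w k))))

∣-weightedSum-schmidt : ∀ n r (w : ℕ → ℤ) x → (∀ m → + n Signed.∣ sumTo n (λ k → w k * + coeff m k)) →
  + n Signed.∣ sumTo n (λ k → w k * schmidt (suc r) k x)
∣-weightedSum-schmidt n r w x n∣basis = subst (+ n Signed.∣_) (sym (weightedSum-schmidt n r w x))
  (∣-sumTo n _ (λ j → ∣m⇒∣m*n (x ^ j) (∣-weightedSum-Span n w n∣basis (coeff-powers-Span j (suc r)))))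

∣-odd-weighted-coeff-sum : ∀ n m → + n Signed.∣ sumTo n (λ k → + suc (2 ℕ.* k) * + coeff m k)
∣-odd-weighted-coeff-sum n m = divides (+ q) (begin
  sumTo n (λ k → + suc (2 ℕ.* k) * + coeff m k)   ≡⟨ sumTo-cong n (λ k → pos-* (suc (2 ℕ.* k)) (coeff m k)) ⟨
  sumTo n (λ k → + (suc (2 ℕ.* k) ℕ.* coeff m k)) ≡⟨ sumTo-sumℕ n _ ⟩
  + sumℕ n (λ k → suc (2 ℕ.* k) ℕ.* coeff m k)    ≡⟨ cong +_ (trans (odd-weighted-coeff-sum n m) (ℕ.*-comm n q)) ⟩
  + (q ℕ.* n)                                     ≡⟨ pos-* q n ⟩
  + q * + n                                       ∎)
  where q = binom n (suc m) ℕ.* binom (n ℕ.+ m) m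

alternating-coeff-sum : ∀ n m →
  sumTo (suc n) (λ k → (sign k * + suc (2 ℕ.* k)) * + coeff m k) ≡ sign n * + alternatingClosedForm n m
alternating-coeff-sum zero    zero    = refl
alternating-coeff-sum zero    (suc m) = refl
alternating-coeff-sum (suc n) m = begin
  sumTo (suc n) (λ k → (sign k * + suc (2 ℕ.* k)) * + coeff m k) + (- s * + c) * + a
    ≡⟨ cong (_+ (- s * + c) * + a) (alternating-coeff-sum n m) ⟩
  s * + X + (- s * + c) * + a
    ≡⟨ cong (λ v → s * + X + v) (trans (*-assoc (- s) (+ c) (+ a)) (cong (- s *_) (sym (pos-* c a)))) ⟩
  s * + X + - s * + (c ℕ.* a)
    ≡⟨ cong (λ v → s * + X + - s * v) (trans (cong +_ (sym (alternatingClosedForm-step n m))) (pos-+ X Y)) ⟩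
  s * + X + - s * (+ X + + Y)
    ≡⟨ telescope s (+ X) (+ Y) ⟩
  - s * + Y ∎
  where
  s = sign n
  c = suc (2 ℕ.* suc n)
  a = coeff m (suc n)
  X = alternatingClosedForm n m
  Y = alternatingClosedForm (suc n) m
  telescope : ∀ s x y → s * x + - s * (x + y) ≡ - s * y
  telescope = solve-∀

∣-alternating-coeff-sum : ∀ n m → + n Signed.∣ sumTo n (λ k → (sign k * + suc (2 ℕ.* k)) * + coeff m k)
∣-alternating-coeff-sum zero    m = divides (+ 0) refl
∣-alternating-coeff-sum (suc n) m = divides (sign n * + q)
  (trans (alternating-coeff-sum n m) (trans (cong (sign n *_) (pos-* (suc n) q)) (rearrange (sign n) (+ suc n) (+ q))))
  where
  q = binom n m ℕ.* binom (suc n ℕ.+ m) m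
  rearrange : ∀ s x y → s * (x * y) ≡ s * y * x
  rearrange = solve-∀

theorem4p1 : (n r : ℕ) → 1 ≤ n → 2 ≤ r → (x : ℤ) →
    ((+ n) ∣ sumTo n (λ k → + (suc (2 ℕ.* k)) * schmidt r k x))
    × ((+ n) ∣ sumTo n (λ k → sign k * (+ (suc (2 ℕ.* k)) * schmidt r k x)))
theorem4p1 n (suc r) _ (s≤s _) x =
  ∣⇒∣ᵤ (∣-weightedSum-schmidt n r (λ k → + suc (2 ℕ.* k)) x (∣-odd-weighted-coeff-sum n)) ,
  ∣⇒∣ᵤ (subst (+ n Signed.∣_) (sumTo-cong n (λ k → *-assoc (sign k) (+ suc (2 ℕ.* k)) _))
              (∣-weightedSum-schmidt n r (λ k → sign k * + suc (2 ℕ.* k)) x (∣-alternating-coeff-sum n)))
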